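{- Let $n,s,k$ be integers with $k\ge 1$ and $k+2\le s\le n$. Then $p^s_{n;\le s;k+1}=p^1_{n;\le s;k}$.
   Context: Parking model: there are $n$ parking spaces in a line, numbered $1,\dots,n$. A preference set of length $n$ is a sequence $(a_1,\dots,a_n)$ of integers with $1\le a_i\le n$; cars $1,\dots,n$ arrive in order, car $i$ parks in the first unoccupied space numbered $\ge a_i$ if one exists, otherwise it fails to park. It is a $k$-flaw preference set if exactly $k$ cars fail to park. $p^l_{n;\le s;k}$ denotes the number of $k$-flaw preference sets $(a_1,\dots,a_n)$ with $n$ spaces such that $a_i\le s$ for all $i$ and $a_1=l$. -}

module Defs where

open import Data.Nat using (ℕ; zero; suc; _+_; _∸_; _≤?_; _≟_)
open import Data.Bool using (Bool; true; false; _∧_)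
open import Data.Maybe using (Maybe; just; nothing)
open import Data.List using (List; []; _∷_; length; filterᵇ; map; concatMap)
open import Data.Bool.ListAction using (all; any)
open import Relation.Nullary.Decidable using (⌊_⌋)
open import Relation.Binary.PropositionalEquality using (_≡_)

rangeFrom : ℕ → ℕ → List ℕ
rangeFrom i zero = []
rangeFrom i (suc m) = i ∷ rangeFrom (suc i) m

range1 : ℕ → List ℕ
range1 n = rangeFrom 1 n

seqs : ℕ → ℕ → List (List ℕ)
seqs zero n = [] ∷ []
seqs (suc len) n = concatMap (λ a → map (a ∷_) (seqs len n)) (range1 n)

prefSets : ℕ → List (List ℕ)
prefSets n = seqs n n

occupiedB : ℕ → List ℕ → Bool
occupiedB x occ = any (λ y → ⌊ x ≟ y ⌋) occ

firstFree : List ℕ → List ℕ → Maybe ℕ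
firstFree [] occ = nothing
firstFree (j ∷ js) occ with occupiedB j occ
... | true = firstFree js occ
... | false = just j

spacesFrom : ℕ → ℕ → List ℕ
spacesFrom n a = rangeFrom a (suc n ∸ a)

failures : ℕ → List ℕ → List ℕ → ℕ
failures n occ [] = 0
failures n occ (a ∷ as) with firstFree (spacesFrom n a) occ
... | just j = failures n (j ∷ occ) as
... | nothing = suc (failures n occ as)

flaws : ℕ → List ℕ → ℕ
flaws n as = failures n [] as

headIs : ℕ → List ℕ → Bool
headIs l [] = false
headIs l (a ∷ _) = ⌊ a ≟ l ⌋

-- p^l_{n; ≤ s; k}: number of k-flaw preference sets of length n with
-- all a_i ≤ s and a_1 = l
p : (n s k l : ℕ) → ℕ
p n s k l = length (filterᵇ (λ as → ⌊ flaws n as ≟ k ⌋ ∧ all (λ a → ⌊ a ≤? s ⌋) as ∧ headIs l as)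
                           (prefSets n))

-- The number of cars that fail to park does not depend on the order of arrival: swapping two
-- consecutive cars leaves it unchanged, so car 1 may be moved to the end of the queue.  A last car
-- with preference 1 always parks, since the other n − 1 cars occupy at most n − 1 of the n spaces.
-- A last car with preference s fails whenever an earlier car failed, because a car with preference
-- at most s fails only if every space from s on is taken; if no earlier car failed, at most one car
-- fails in total.  So for k ≥ 1, changing a₁ = 1 into a₁ = s maps the k-flaw sets counted by
-- p^1 bijectively onto the (k+1)-flaw sets counted by p^s.
module Submission where

open import Defs
open import Data.Nat using (ℕ; zero; suc; _≤_; _<_; _+_; _∸_; z≤n; s≤s; s≤s⁻¹; _≟_; _≤?_; _≤′_; ≤′-refl; ≤′-step)
open import Data.Nat.Properties
open import Data.Bool using (Bool; true; false; _∧_; _∨_; if_then_else_)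
open import Data.Bool.Properties using (∨-assoc; ∨-comm; ∨-zeroʳ; ∧-zeroʳ; ∧-identityʳ)
open import Data.Bool.ListAction using (all)
open import Data.Maybe using (just; nothing)
open import Data.List using (List; []; _∷_; [_]; _++_; length; map; filterᵇ; concatMap)
open import Data.List.Properties using (filter-++; length-++)
open import Data.List.Relation.Unary.All as All using (All; []; _∷_)
open import Data.List.Relation.Unary.All.Properties using (++⁺; map⁺)
open import Function using (_∘_)
open import Function.Bundles using (_⇔_; mk⇔)
open import Relation.Nullary using (Dec; ¬_; yes; no; contradiction)
open import Relation.Nullary.Decidable using (⌊_⌋; T?; isYes≗does; dec-true; dec-false; does-⇔)
open import Relation.Binary.PropositionalEquality hiding ([_])

⌊⌋-true : ∀ {p} {A : Set p} (a? : Dec A) → A → ⌊ a? ⌋ ≡ true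
⌊⌋-true a? a = trans (isYes≗does a?) (dec-true a? a)

⌊⌋-false : ∀ {p} {A : Set p} (a? : Dec A) → ¬ A → ⌊ a? ⌋ ≡ false
⌊⌋-false a? ¬a = trans (isYes≗does a?) (dec-false a? ¬a)

⌊⌋-⇔ : ∀ {p q} {A : Set p} {B : Set q} → A ⇔ B → (a? : Dec A) (b? : Dec B) → ⌊ a? ⌋ ≡ ⌊ b? ⌋
⌊⌋-⇔ A⇔B a? b? = trans (isYes≗does a?) (trans (does-⇔ A⇔B a? b?) (sym (isYes≗does b?)))

∧-congˡ-guarded : ∀ {x y} b → (b ≡ true → x ≡ y) → x ∧ b ≡ y ∧ b
∧-congˡ-guarded true x≡y = cong (_∧ true) (x≡y refl)
∧-congˡ-guarded {x} {y} false x≡y = trans (∧-zeroʳ x) (sym (∧-zeroʳ y))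

count : ∀ {A : Set} → (A → Bool) → List A → ℕ
count P xs = length (filterᵇ P xs)

count-++ : ∀ {A : Set} (P : A → Bool) xs ys → count P (xs ++ ys) ≡ count P xs + count P ys
count-++ P xs ys = trans (cong length (filter-++ (T? ∘ P) xs ys)) (length-++ (filterᵇ P xs))

count-map : ∀ {A B : Set} (P : B → Bool) (f : A → B) xs → count P (map f xs) ≡ count (P ∘ f) xs
count-map P f [] = refl
count-map P f (x ∷ xs) with P (f x)
... | true = cong suc (count-map P f xs)
... | false = count-map P f xs

count-cong : ∀ {A : Set} {P Q : A → Bool} {xs} → All (λ x → P x ≡ Q x) xs → count P xs ≡ count Q xs
count-cong [] = refl
count-cong {P = P} {Q} {x ∷ xs} (e ∷ es) with P x | Q x
... | true | true = cong suc (count-cong es)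
... | false | false = count-cong es

module _ (P : List ℕ → Bool) (l : ℕ) (P-head : ∀ a t → a ≢ l → P (a ∷ t) ≡ false) (ts : List (List ℕ)) where

  private
    blocks : List ℕ → List (List ℕ)
    blocks = concatMap (λ a → map (a ∷_) ts)

  count-block-other : ∀ a → a ≢ l → count P (map (a ∷_) ts) ≡ 0
  count-block-other a a≢l = trans (count-map P (a ∷_) ts) (count-none ts)
    where
      count-none : ∀ us → count (λ t → P (a ∷ t)) us ≡ 0
      count-none [] = refl
      count-none (u ∷ us) rewrite P-head a u a≢l = count-none us

  count-blocks-∷ : ∀ c r → count P (blocks (rangeFrom c (suc r)))
                         ≡ count P (map (c ∷_) ts) + count P (blocks (rangeFrom (suc c) r))
  count-blocks-∷ c r = count-++ P (map (c ∷_) ts) (blocks (rangeFrom (suc c) r))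

  count-blocks-above : ∀ c r → l < c → count P (blocks (rangeFrom c r)) ≡ 0
  count-blocks-above c zero l<c = refl
  count-blocks-above c (suc r) l<c =
    trans (count-blocks-∷ c r) (cong₂ _+_ (count-block-other c c≢l) (count-blocks-above (suc c) r (m<n⇒m<1+n l<c)))
    where
      c≢l : c ≢ l
      c≢l c≡l = <⇒≢ l<c (sym c≡l)

  count-blocks : ∀ c r → c ≤ l → l < c + r → count P (blocks (rangeFrom c r)) ≡ count (λ t → P (l ∷ t)) ts
  count-blocks c zero c≤l l<c+0 = contradiction (subst (l <_) (+-identityʳ c) l<c+0) (≤⇒≯ c≤l)
  count-blocks c (suc r) c≤l l<c+1+r with c ≟ l
  ... | yes refl = begin
    count P (blocks (rangeFrom c (suc r)))                            ≡⟨ count-blocks-∷ c r ⟩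
    count P (map (c ∷_) ts) + count P (blocks (rangeFrom (suc c) r))  ≡⟨ cong₂ _+_ (count-map P (c ∷_) ts) (count-blocks-above (suc c) r (n<1+n c)) ⟩
    count (λ t → P (c ∷ t)) ts + 0                                   ≡⟨ +-identityʳ _ ⟩
    count (λ t → P (c ∷ t)) ts                                       ∎
    where open ≡-Reasoning
  ... | no c≢l = begin
    count P (blocks (rangeFrom c (suc r)))                            ≡⟨ count-blocks-∷ c r ⟩
    count P (map (c ∷_) ts) + count P (blocks (rangeFrom (suc c) r))  ≡⟨ cong (_+ count P (blocks (rangeFrom (suc c) r))) (count-block-other c c≢l) ⟩
    count P (blocks (rangeFrom (suc c) r))                            ≡⟨ count-blocks (suc c) r c<l (subst (l <_) (+-suc c r) l<c+1+r) ⟩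
    count (λ t → P (l ∷ t)) ts                                       ∎
    where
      open ≡-Reasoning
      c<l : c < l
      c<l = ≤∧≢⇒< c≤l c≢l

seqs-length : ∀ m n → All (λ t → length t ≡ m) (seqs m n)
seqs-length zero n = refl ∷ []
seqs-length (suc m) n = blocks (range1 n)
  where
    blocks : ∀ as → All (λ t → length t ≡ suc m) (concatMap (λ a → map (a ∷_) (seqs m n)) as)
    blocks [] = []
    blocks (a ∷ as) = ++⁺ (map⁺ (All.map (cong suc) (seqs-length m n))) (blocks as)

_⊑_ : List ℕ → List ℕ → Set
O ⊑ O′ = ∀ x → occupiedB x O ≡ true → occupiedB x O′ ≡ true

_≋_ : List ℕ → List ℕ → Set
O ≋ O′ = ∀ x → occupiedB x O ≡ occupiedB x O′

⊑-∷ : ∀ i O → O ⊑ (i ∷ O)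
⊑-∷ i O x e rewrite e = ∨-zeroʳ _

≋-∷ : ∀ i {O O′} → O ≋ O′ → (i ∷ O) ≋ (i ∷ O′)
≋-∷ i e x = cong (⌊ x ≟ i ⌋ ∨_) (e x)

≋-swap : ∀ i j O → (i ∷ j ∷ O) ≋ (j ∷ i ∷ O)
≋-swap i j O x = begin
  ⌊ x ≟ i ⌋ ∨ (⌊ x ≟ j ⌋ ∨ occupiedB x O)  ≡⟨ ∨-assoc ⌊ x ≟ i ⌋ ⌊ x ≟ j ⌋ (occupiedB x O) ⟨
  (⌊ x ≟ i ⌋ ∨ ⌊ x ≟ j ⌋) ∨ occupiedB x O  ≡⟨ cong (_∨ occupiedB x O) (∨-comm ⌊ x ≟ i ⌋ ⌊ x ≟ j ⌋) ⟩
  (⌊ x ≟ j ⌋ ∨ ⌊ x ≟ i ⌋) ∨ occupiedB x O  ≡⟨ ∨-assoc ⌊ x ≟ j ⌋ ⌊ x ≟ i ⌋ (occupiedB x O) ⟩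
  ⌊ x ≟ j ⌋ ∨ (⌊ x ≟ i ⌋ ∨ occupiedB x O)  ∎
  where open ≡-Reasoning

occupiedB-∷-free : ∀ {x i} O → x ≢ i → occupiedB x O ≡ false → occupiedB x (i ∷ O) ≡ false
occupiedB-∷-free {x} {i} O x≢i e rewrite ⌊⌋-false (x ≟ i) x≢i = e

occupiedB-head : ∀ i O → occupiedB i (i ∷ O) ≡ true
occupiedB-head i O rewrite ⌊⌋-true (i ≟ i) refl = refl

firstFree-∷-occupied : ∀ j js O → occupiedB j O ≡ true → firstFree (j ∷ js) O ≡ firstFree js O
firstFree-∷-occupied j js O e rewrite e = refl

firstFree-∷-free : ∀ j js O → occupiedB j O ≡ false → firstFree (j ∷ js) O ≡ just j
firstFree-∷-free j js O e rewrite e = refl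

firstFree-just⇒free : ∀ js O {i} → firstFree js O ≡ just i → occupiedB i O ≡ false
firstFree-just⇒free (j ∷ js) O e with occupiedB j O in occ
... | true = firstFree-just⇒free js O e
... | false with refl ← e = occ

firstFree-nothing-⊑ : ∀ js O O′ → O ⊑ O′ → firstFree js O ≡ nothing → firstFree js O′ ≡ nothing
firstFree-nothing-⊑ [] O O′ O⊑O′ e = refl
firstFree-nothing-⊑ (j ∷ js) O O′ O⊑O′ e with occupiedB j O in occ
... | true = trans (firstFree-∷-occupied j js O′ (O⊑O′ j occ)) (firstFree-nothing-⊑ js O O′ O⊑O′ e)

firstFree-just-⊑ : ∀ js O O′ {i} → O ⊑ O′ → occupiedB i O′ ≡ false →
                   firstFree js O ≡ just i → firstFree js O′ ≡ just i
firstFree-just-⊑ (j ∷ js) O O′ O⊑O′ free e with occupiedB j O in occ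
... | true = trans (firstFree-∷-occupied j js O′ (O⊑O′ j occ)) (firstFree-just-⊑ js O O′ O⊑O′ free e)
... | false with refl ← e = firstFree-∷-free j js O′ free

firstFree-just-∷ : ∀ js O l {k} → firstFree js O ≡ just k → k ≢ l → firstFree js (l ∷ O) ≡ just k
firstFree-just-∷ js O l e k≢l =
  firstFree-just-⊑ js O (l ∷ O) (⊑-∷ l O) (occupiedB-∷-free O k≢l (firstFree-just⇒free js O e)) e

firstFree-cong : ∀ js O O′ → O ≋ O′ → firstFree js O ≡ firstFree js O′
firstFree-cong [] O O′ e = refl
firstFree-cong (j ∷ js) O O′ e with occupiedB j O in occ
... | true = trans (firstFree-cong js O O′ e) (sym (firstFree-∷-occupied j js O′ (trans (sym (e j)) occ)))
... | false = sym (firstFree-∷-free j js O′ (trans (sym (e j)) occ))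

-- Once the space i found from a is taken, every space from a to i is taken.
firstFree-rangeFrom-resume : ∀ a m O O′ {i} →
                             firstFree (rangeFrom a m) O ≡ just i → O ⊑ O′ → occupiedB i O′ ≡ true →
                             firstFree (rangeFrom a m) O′ ≡ firstFree (rangeFrom (suc i) (a + m ∸ suc i)) O′
firstFree-rangeFrom-resume a (suc m) O O′ {i} e O⊑O′ occ-i with occupiedB a O in occ
... | true = begin
  firstFree (rangeFrom a (suc m)) O′                   ≡⟨ firstFree-∷-occupied a _ O′ (O⊑O′ a occ) ⟩
  firstFree (rangeFrom (suc a) m) O′                   ≡⟨ firstFree-rangeFrom-resume (suc a) m O O′ e O⊑O′ occ-i ⟩
  firstFree (rangeFrom (suc i) (suc a + m ∸ suc i)) O′ ≡⟨ cong (λ z → firstFree (rangeFrom (suc i) (z ∸ suc i)) O′) (+-suc a m) ⟨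
  firstFree (rangeFrom (suc i) (a + suc m ∸ suc i)) O′ ∎
  where open ≡-Reasoning
... | false with refl ← e = begin
  firstFree (rangeFrom a (suc m)) O′                   ≡⟨ firstFree-∷-occupied a _ O′ occ-i ⟩
  firstFree (rangeFrom (suc a) m) O′                   ≡⟨ cong (λ z → firstFree (rangeFrom (suc a) z) O′) remaining ⟨
  firstFree (rangeFrom (suc a) (a + suc m ∸ suc a)) O′ ∎
  where
    open ≡-Reasoning
    remaining : a + suc m ∸ suc a ≡ m
    remaining = trans (cong (_∸ suc a) (+-suc a m)) (m+n∸m≡n (suc a) m)

rangeFrom-full-tail : ∀ c m O → firstFree (rangeFrom c m) O ≡ nothing → firstFree (rangeFrom (suc c) (m ∸ 1)) O ≡ nothing
rangeFrom-full-tail c zero O e = refl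
rangeFrom-full-tail c (suc m) O e with occupiedB c O
... | true = e

-- Pigeonhole for spaces

freeCount : List ℕ → List ℕ → ℕ
freeCount [] O = 0
freeCount (j ∷ js) O = (if occupiedB j O then 0 else 1) + freeCount js O

freeCount-[] : ∀ js → freeCount js [] ≡ length js
freeCount-[] [] = refl
freeCount-[] (j ∷ js) = cong suc (freeCount-[] js)

freeCount-full : ∀ js O → firstFree js O ≡ nothing → freeCount js O ≡ 0
freeCount-full [] O e = refl
freeCount-full (j ∷ js) O e with occupiedB j O
... | true = freeCount-full js O e

freeCount-rangeFrom-below : ∀ i c m O → i < c → freeCount (rangeFrom c m) (i ∷ O) ≡ freeCount (rangeFrom c m) O
freeCount-rangeFrom-below i c zero O i<c = refl
freeCount-rangeFrom-below i c (suc m) O i<c rewrite ⌊⌋-false (c ≟ i) (λ c≡i → <⇒≢ i<c (sym c≡i)) =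
  cong (_ +_) (freeCount-rangeFrom-below i (suc c) m O (m<n⇒m<1+n i<c))

if-0-1-≤1 : ∀ b → (if b then 0 else 1) ≤ 1
if-0-1-≤1 true = z≤n
if-0-1-≤1 false = s≤s z≤n

freeCount-rangeFrom-∷ : ∀ i c m O → freeCount (rangeFrom c m) O ≤ suc (freeCount (rangeFrom c m) (i ∷ O))
freeCount-rangeFrom-∷ i c zero O = z≤n
freeCount-rangeFrom-∷ i c (suc m) O with c ≟ i
... | yes refl rewrite freeCount-rangeFrom-below c (suc c) m O (n<1+n c) =
  +-monoˡ-≤ (freeCount (rangeFrom (suc c) m) O) (if-0-1-≤1 (occupiedB c O))
... | no c≢i = ≤-trans (+-monoʳ-≤ (if occupiedB c O then 0 else 1) (freeCount-rangeFrom-∷ i (suc c) m O))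
                      (≤-reflexive (+-suc _ _))

length-rangeFrom : ∀ c m → length (rangeFrom c m) ≡ m
length-rangeFrom c zero = refl
length-rangeFrom c (suc m) = cong suc (length-rangeFrom (suc c) m)

freeCount-rangeFrom-lower : ∀ c m O → m ≤ freeCount (rangeFrom c m) O + length O
freeCount-rangeFrom-lower c m [] =
  ≤-reflexive (sym (trans (+-identityʳ _) (trans (freeCount-[] (rangeFrom c m)) (length-rangeFrom c m))))
freeCount-rangeFrom-lower c m (i ∷ O) = begin
  m                                                  ≤⟨ freeCount-rangeFrom-lower c m O ⟩
  freeCount (rangeFrom c m) O + length O             ≤⟨ +-monoˡ-≤ (length O) (freeCount-rangeFrom-∷ i c m O) ⟩
  suc (freeCount (rangeFrom c m) (i ∷ O)) + length O ≡⟨ +-suc _ (length O) ⟨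
  freeCount (rangeFrom c m) (i ∷ O) + length (i ∷ O) ∎
  where open ≤-Reasoning

rangeFrom-full⇒≤length : ∀ c m O → firstFree (rangeFrom c m) O ≡ nothing → m ≤ length O
rangeFrom-full⇒≤length c m O e =
  subst (λ f → m ≤ f + length O) (freeCount-full (rangeFrom c m) O e) (freeCount-rangeFrom-lower c m O)

-- The parking process

occupiedAfter : ℕ → List ℕ → List ℕ → List ℕ
occupiedAfter n O [] = O
occupiedAfter n O (a ∷ as) with firstFree (spacesFrom n a) O
... | just j = occupiedAfter n (j ∷ O) as
... | nothing = occupiedAfter n O as

module _ (n : ℕ) where

  spacesFrom-resume : ∀ a O O′ {i} → firstFree (spacesFrom n a) O ≡ just i → O ⊑ O′ → occupiedB i O′ ≡ true →
                      firstFree (spacesFrom n a) O′ ≡ firstFree (spacesFrom n (suc i)) O′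
  spacesFrom-resume a O O′ {i} e O⊑O′ occ-i with suc n ∸ a in len
  ... | zero with () ← e
  ... | suc m = trans (firstFree-rangeFrom-resume a (suc m) O O′ e O⊑O′ occ-i)
                      (cong (λ z → firstFree (rangeFrom (suc i) (z ∸ suc i)) O′) a+len≡1+n)
    where
      a+len≡1+n : a + suc m ≡ suc n
      a+len≡1+n = trans (cong (a +_) (sym len))
                        (m+[n∸m]≡n (<⇒≤ (m∸n≢0⇒n<m {suc n} {a} λ len≡0 → 0≢1+n (trans (sym len≡0) len))))

  spacesFrom-full-suc : ∀ a O → firstFree (spacesFrom n a) O ≡ nothing → firstFree (spacesFrom n (suc a)) O ≡ nothing
  spacesFrom-full-suc a O e =
    subst (λ m → firstFree (rangeFrom (suc a) m) O ≡ nothing) len (rangeFrom-full-tail a (suc n ∸ a) O e)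
    where
      len : suc n ∸ a ∸ 1 ≡ n ∸ a
      len = trans (∸-+-assoc (suc n) a 1) (cong (suc n ∸_) (+-comm a 1))

  spacesFrom-full-mono : ∀ O {a b} → a ≤′ b →
                         firstFree (spacesFrom n a) O ≡ nothing → firstFree (spacesFrom n b) O ≡ nothing
  spacesFrom-full-mono O ≤′-refl e = e
  spacesFrom-full-mono O {b = suc b} (≤′-step a≤′b) e = spacesFrom-full-suc b O (spacesFrom-full-mono O a≤′b e)

  failures-park : ∀ O a t {j} → firstFree (spacesFrom n a) O ≡ just j → failures n O (a ∷ t) ≡ failures n (j ∷ O) t
  failures-park O a t e rewrite e = refl

  failures-fail : ∀ O a t → firstFree (spacesFrom n a) O ≡ nothing → failures n O (a ∷ t) ≡ suc (failures n O t)
  failures-fail O a t e rewrite e = refl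

  failures-cong : ∀ t {O O′} → O ≋ O′ → failures n O t ≡ failures n O′ t
  failures-cong [] e = refl
  failures-cong (a ∷ t) {O} {O′} e with firstFree (spacesFrom n a) O in spot
  ... | just j = trans (failures-cong t (≋-∷ j {O} {O′} e))
                       (sym (failures-park O′ a t (trans (sym (firstFree-cong (spacesFrom n a) O O′ e)) spot)))
  ... | nothing = trans (cong suc (failures-cong t e))
                        (sym (failures-fail O′ a t (trans (sym (firstFree-cong (spacesFrom n a) O O′ e)) spot)))

  failures-same-spot : ∀ O a b t → firstFree (spacesFrom n a) O ≡ firstFree (spacesFrom n b) O →
                       failures n O (a ∷ t) ≡ failures n O (b ∷ t)
  failures-same-spot O a b t same with firstFree (spacesFrom n a) O
  ... | just j = sym (failures-park O b t (sym same))
  ... | nothing = sym (failures-fail O b t (sym same))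

  failures-swap-fail-park : ∀ O a b t {j} →
                            firstFree (spacesFrom n a) O ≡ nothing → firstFree (spacesFrom n b) O ≡ just j →
                            failures n O (a ∷ b ∷ t) ≡ failures n O (b ∷ a ∷ t)
  failures-swap-fail-park O a b t {j} fa pb = begin
    failures n O (a ∷ b ∷ t)    ≡⟨ failures-fail O a (b ∷ t) fa ⟩
    suc (failures n O (b ∷ t))  ≡⟨ cong suc (failures-park O b t pb) ⟩
    suc (failures n (j ∷ O) t)  ≡⟨ failures-fail (j ∷ O) a t (firstFree-nothing-⊑ (spacesFrom n a) O (j ∷ O) (⊑-∷ j O) fa) ⟨
    failures n (j ∷ O) (a ∷ t)  ≡⟨ failures-park O b (a ∷ t) pb ⟨
    failures n O (b ∷ a ∷ t)    ∎
    where open ≡-Reasoning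

  failures-swap-park-park : ∀ O a b t {i j} → i ≢ j →
                            firstFree (spacesFrom n a) O ≡ just i → firstFree (spacesFrom n b) O ≡ just j →
                            failures n O (a ∷ b ∷ t) ≡ failures n O (b ∷ a ∷ t)
  failures-swap-park-park O a b t {i} {j} i≢j pa pb = begin
    failures n O (a ∷ b ∷ t)    ≡⟨ failures-park O a (b ∷ t) pa ⟩
    failures n (i ∷ O) (b ∷ t)  ≡⟨ failures-park (i ∷ O) b t (firstFree-just-∷ (spacesFrom n b) O i pb (λ j≡i → i≢j (sym j≡i))) ⟩
    failures n (j ∷ i ∷ O) t    ≡⟨ failures-cong t (≋-swap j i O) ⟩
    failures n (i ∷ j ∷ O) t    ≡⟨ failures-park (j ∷ O) a t (firstFree-just-∷ (spacesFrom n a) O j pa i≢j) ⟨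
    failures n (j ∷ O) (a ∷ t)  ≡⟨ failures-park O b (a ∷ t) pb ⟨
    failures n O (b ∷ a ∷ t)    ∎
    where open ≡-Reasoning

  -- Whichever of the two cars comes second resumes its search at i + 1.
  failures-swap-park-same : ∀ O a b t {i} →
                            firstFree (spacesFrom n a) O ≡ just i → firstFree (spacesFrom n b) O ≡ just i →
                            failures n O (a ∷ b ∷ t) ≡ failures n O (b ∷ a ∷ t)
  failures-swap-park-same O a b t {i} pa pb = begin
    failures n O (a ∷ b ∷ t)    ≡⟨ failures-park O a (b ∷ t) pa ⟩
    failures n (i ∷ O) (b ∷ t)  ≡⟨ failures-same-spot (i ∷ O) b a t (trans (resume b pb) (sym (resume a pa))) ⟩
    failures n (i ∷ O) (a ∷ t)  ≡⟨ failures-park O b (a ∷ t) pb ⟨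
    failures n O (b ∷ a ∷ t)    ∎
    where
      open ≡-Reasoning
      resume : ∀ c → firstFree (spacesFrom n c) O ≡ just i →
               firstFree (spacesFrom n c) (i ∷ O) ≡ firstFree (spacesFrom n (suc i)) (i ∷ O)
      resume c pc = spacesFrom-resume c O (i ∷ O) pc (⊑-∷ i O) (occupiedB-head i O)

  failures-swap : ∀ O a b t → failures n O (a ∷ b ∷ t) ≡ failures n O (b ∷ a ∷ t)
  failures-swap O a b t = by-spots _ refl _ refl
    where
      by-spots : ∀ sa → firstFree (spacesFrom n a) O ≡ sa → ∀ sb → firstFree (spacesFrom n b) O ≡ sb →
                 failures n O (a ∷ b ∷ t) ≡ failures n O (b ∷ a ∷ t)
      by-spots nothing fa nothing fb = begin
        failures n O (a ∷ b ∷ t)    ≡⟨ failures-fail O a (b ∷ t) fa ⟩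
        suc (failures n O (b ∷ t))  ≡⟨ cong suc (failures-fail O b t fb) ⟩
        suc (suc (failures n O t))  ≡⟨ cong suc (failures-fail O a t fa) ⟨
        suc (failures n O (a ∷ t))  ≡⟨ failures-fail O b (a ∷ t) fb ⟨
        failures n O (b ∷ a ∷ t)    ∎
        where open ≡-Reasoning
      by-spots nothing fa (just j) pb = failures-swap-fail-park O a b t fa pb
      by-spots (just i) pa nothing fb = sym (failures-swap-fail-park O b a t fb pa)
      by-spots (just i) pa (just j) pb with i ≟ j
      ... | no i≢j = failures-swap-park-park O a b t i≢j pa pb
      ... | yes refl = failures-swap-park-same O a b t pa pb

  failures-first-to-last : ∀ O a t → failures n O (a ∷ t) ≡ failures n O t + failures n (occupiedAfter n O t) [ a ]
  failures-first-to-last O a [] = refl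
  failures-first-to-last O a (b ∷ t) rewrite failures-swap O a b t with firstFree (spacesFrom n b) O
  ... | just j = failures-first-to-last (j ∷ O) a t
  ... | nothing = cong suc (failures-first-to-last O a t)

  failures-singleton-≤1 : ∀ a O → failures n O [ a ] ≤ 1
  failures-singleton-≤1 a O with firstFree (spacesFrom n a) O
  ... | just _ = z≤n
  ... | nothing = s≤s z≤n

  failures-singleton-fail : ∀ a O → firstFree (spacesFrom n a) O ≡ nothing → failures n O [ a ] ≡ 1
  failures-singleton-fail a O e rewrite e = refl

  failures-singleton-park : ∀ a O → firstFree (spacesFrom n a) O ≢ nothing → failures n O [ a ] ≡ 0
  failures-singleton-park a O e with firstFree (spacesFrom n a) O
  ... | just _ = refl
  ... | nothing = contradiction refl e

  ⊑-occupiedAfter : ∀ O t → O ⊑ occupiedAfter n O t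
  ⊑-occupiedAfter O [] x e = e
  ⊑-occupiedAfter O (a ∷ t) with firstFree (spacesFrom n a) O
  ... | just j = λ x e → ⊑-occupiedAfter (j ∷ O) t x (⊑-∷ j O x e)
  ... | nothing = ⊑-occupiedAfter O t

  length-occupiedAfter : ∀ O t → length (occupiedAfter n O t) ≤ length O + length t
  length-occupiedAfter O [] = ≤-reflexive (sym (+-identityʳ _))
  length-occupiedAfter O (a ∷ t) with firstFree (spacesFrom n a) O
  ... | just j = ≤-trans (length-occupiedAfter (j ∷ O) t) (≤-reflexive (sym (+-suc (length O) (length t))))
  ... | nothing = ≤-trans (length-occupiedAfter O t) (+-monoʳ-≤ (length O) (n≤1+n (length t)))

  failure⇒spacesFrom-full : ∀ s O t → All (_≤ s) t → 1 ≤ failures n O t →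
                            firstFree (spacesFrom n s) (occupiedAfter n O t) ≡ nothing
  failure⇒spacesFrom-full s O (a ∷ t) (a≤s ∷ t≤s) fails with firstFree (spacesFrom n a) O in spot
  ... | just j = failure⇒spacesFrom-full s (j ∷ O) t t≤s fails
  ... | nothing = firstFree-nothing-⊑ (spacesFrom n s) O (occupiedAfter n O t) (⊑-occupiedAfter O t)
                    (spacesFrom-full-mono O (≤⇒≤′ a≤s) spot)

-- Replacing the first preference

occupiedAfter-not-full : ∀ m t → length t ≡ m → firstFree (spacesFrom (suc m) 1) (occupiedAfter (suc m) [] t) ≢ nothing
occupiedAfter-not-full m t len full = 1+n≰n (begin
  suc m     ≤⟨ rangeFrom-full⇒≤length 1 (suc m) O full ⟩
  length O  ≤⟨ length-occupiedAfter (suc m) [] t ⟩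
  length t  ≡⟨ len ⟩
  m         ∎)
  where
    open ≤-Reasoning
    O = occupiedAfter (suc m) [] t

flaws-∷-1 : ∀ m t → length t ≡ m → flaws (suc m) (1 ∷ t) ≡ flaws (suc m) t
flaws-∷-1 m t len = begin
  flaws (suc m) (1 ∷ t)                       ≡⟨ failures-first-to-last (suc m) [] 1 t ⟩
  flaws (suc m) t + failures (suc m) O [ 1 ]  ≡⟨ cong (flaws (suc m) t +_) (failures-singleton-park (suc m) 1 O (occupiedAfter-not-full m t len)) ⟩
  flaws (suc m) t + 0                         ≡⟨ +-identityʳ _ ⟩
  flaws (suc m) t                             ∎
  where
    open ≡-Reasoning
    O = occupiedAfter (suc m) [] t

flaws-∷-after-failure : ∀ n s t → All (_≤ s) t → 1 ≤ flaws n t → flaws n (s ∷ t) ≡ suc (flaws n t)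
flaws-∷-after-failure n s t t≤s fails = begin
  flaws n (s ∷ t)                 ≡⟨ failures-first-to-last n [] s t ⟩
  flaws n t + failures n O [ s ]  ≡⟨ cong (flaws n t +_) (failures-singleton-fail n s O (failure⇒spacesFrom-full n s [] t t≤s fails)) ⟩
  flaws n t + 1                   ≡⟨ +-comm (flaws n t) 1 ⟩
  suc (flaws n t)                 ∎
  where
    open ≡-Reasoning
    O = occupiedAfter n [] t

flaws-∷-no-failure : ∀ n a t → flaws n t ≡ 0 → flaws n (a ∷ t) ≤ 1
flaws-∷-no-failure n a t none = begin
  flaws n (a ∷ t)                 ≡⟨ failures-first-to-last n [] a t ⟩
  flaws n t + failures n O [ a ]  ≡⟨ cong (_+ failures n O [ a ]) none ⟩
  failures n O [ a ]              ≤⟨ failures-singleton-≤1 n a O ⟩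
  1                               ∎
  where
    open ≤-Reasoning
    O = occupiedAfter n [] t

flaws-shift : ∀ m s k t → 1 ≤ k → length t ≡ m → All (_≤ s) t →
              (flaws (suc m) (s ∷ t) ≡ k + 1) ⇔ (flaws (suc m) (1 ∷ t) ≡ k)
flaws-shift m s k t 1≤k len t≤s rewrite flaws-∷-1 m t len | +-comm k 1 with flaws (suc m) t in f
... | zero = mk⇔ (λ e → contradiction (≤-trans 1≤k (s≤s⁻¹ (subst (_≤ 1) e (flaws-∷-no-failure (suc m) s t f)))) λ ())
                 (λ 0≡k → contradiction (subst (1 ≤_) (sym 0≡k) 1≤k) λ ())
... | suc g = mk⇔ (λ e → suc-injective (trans (sym shifted) e)) (λ g≡k → trans shifted (cong suc g≡k))
  where
    shifted : flaws (suc m) (s ∷ t) ≡ suc (suc g)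
    shifted = trans (flaws-∷-after-failure (suc m) s t t≤s (subst (1 ≤_) (sym f) (s≤s z≤n))) (cong suc f)

all-≤⇒All : ∀ s t → all (λ a → ⌊ a ≤? s ⌋) t ≡ true → All (_≤ s) t
all-≤⇒All s [] e = []
all-≤⇒All s (a ∷ t) e with a ≤? s
... | yes a≤s = a≤s ∷ all-≤⇒All s t e

counted : ℕ → ℕ → ℕ → ℕ → List ℕ → Bool
counted n s k l as = ⌊ flaws n as ≟ k ⌋ ∧ all (λ a → ⌊ a ≤? s ⌋) as ∧ headIs l as

counted-shift : ∀ m s k t → 1 ≤ k → 1 ≤ s → length t ≡ m →
                counted (suc m) s (k + 1) s (s ∷ t) ≡ counted (suc m) s k 1 (1 ∷ t)
counted-shift m s k t 1≤k 1≤s len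
  rewrite ⌊⌋-true (s ≟ s) refl | ⌊⌋-true (1 ≟ 1) refl | ⌊⌋-true (s ≤? s) ≤-refl | ⌊⌋-true (1 ≤? s) 1≤s =
  ∧-congˡ-guarded (all (λ a → ⌊ a ≤? s ⌋) t ∧ true) λ t-bounded →
    ⌊⌋-⇔ (flaws-shift m s k t 1≤k len (all-≤⇒All s t (trans (sym (∧-identityʳ _)) t-bounded)))
         (flaws (suc m) (s ∷ t) ≟ k + 1) (flaws (suc m) (1 ∷ t) ≟ k)

p-as-tail-count : ∀ m s k l → 1 ≤ l → l ≤ suc m →
                  p (suc m) s k l ≡ count (λ t → counted (suc m) s k l (l ∷ t)) (seqs m (suc m))
p-as-tail-count m s k l 1≤l l≤n =
  count-blocks (counted (suc m) s k l) l head-other (seqs m (suc m)) 1 (suc m) 1≤l (s≤s l≤n)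
  where
    head-other : ∀ a t → a ≢ l → counted (suc m) s k l (a ∷ t) ≡ false
    head-other a t a≢l rewrite ⌊⌋-false (a ≟ l) a≢l =
      trans (cong (⌊ flaws (suc m) (a ∷ t) ≟ k ⌋ ∧_) (∧-zeroʳ _)) (∧-zeroʳ _)

theorem6p3 : (n s k : ℕ) → 1 ≤ k → k + 2 ≤ s → s ≤ n →
    p n s (k + 1) s ≡ p n s k 1
theorem6p3 zero s k _ k+2≤s s≤0 = contradiction (≤-trans (m≤n+m 2 k) (≤-trans k+2≤s s≤0)) λ ()
theorem6p3 (suc m) s k 1≤k k+2≤s s≤n = begin
  p (suc m) s (k + 1) s                                              ≡⟨ p-as-tail-count m s (k + 1) s 1≤s s≤n ⟩
  count (λ t → counted (suc m) s (k + 1) s (s ∷ t)) (seqs m (suc m))  ≡⟨ count-cong (All.map (counted-shift m s k _ 1≤k 1≤s) (seqs-length m (suc m))) ⟩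
  count (λ t → counted (suc m) s k 1 (1 ∷ t)) (seqs m (suc m))        ≡⟨ p-as-tail-count m s k 1 ≤-refl (s≤s z≤n) ⟨
  p (suc m) s k 1                                                    ∎
  where
    open ≡-Reasoning
    1≤s : 1 ≤ s
    1≤s = ≤-trans (s≤s z≤n) (≤-trans (m≤n+m 2 k) k+2≤s)
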